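{- Let $K_n$ be the complete graph of order $n$, with edges $e_1,\dots,e_{|E(K_n)|}$, and let $H_i$ be graphs with $n_i$ vertices, $1\le i\le |E(K_n)|$. Let $t=\max_{1\le i\le |E(K_n)|} n_i$. Then $$\chi_{\le 2}(K_n\diamond(H_1,\dots,H_{|E(K_n)|}))\le\begin{cases} n(t+1) & \text{if } n \text{ is odd},\\ n(t+1)-t & \text{if } n \text{ is even}.\end{cases}$$
   Context: For a simple graph $G$ with edge set $\{e_1,\dots,e_m\}$ and simple graphs $H_1,\dots,H_m$, the generalized edge corona product $G\diamond(H_1,\dots,H_m)$ is the graph obtained by taking one (vertex-disjoint) copy of each of $G,H_1,\dots,H_m$ and joining both end vertices of the $i$-th edge $e_i$ of $G$ to every vertex of $H_i$. A $k$-distance coloring of a graph is a vertex coloring in which any two distinct vertices at distance at most $k$ receive different colors; $\chi_{\le k}$ denotes the minimum number of colors in a $k$-distance coloring. -}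

module Defs where

open import Data.Nat using (ℕ; zero; suc; _+_; _*_; _∸_; _≤_; _%_)
open import Data.Fin using (Fin) renaming (_<_ to _<ᶠ_)
open import Data.Product using (Σ; Σ-syntax; _×_; _,_; proj₁; proj₂)
open import Data.Sum using (_⊎_; inj₁; inj₂)
import Relation.Binary.PropositionalEquality
open Relation.Binary.PropositionalEquality using (_≡_; _≢_)
open import Relation.Nullary using (¬_)

record SimpleGraph (V : Set) : Set₁ where
  field
    Adj    : V → V → Set
    sym    : ∀ {u v} → Adj u v → Adj v u
    irrefl : ∀ {v} → ¬ Adj v v
open SimpleGraph public

Edge : ℕ → Set
Edge n = Σ (Fin n × Fin n) (λ p → proj₁ p <ᶠ proj₂ p)

EndOf : ∀ {n} → Fin n → Edge n → Set
EndOf a ((u , v) , _) = (a ≡ u) ⊎ (a ≡ v)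

-- Vertex set of K_n ◇ (H_e)_{e ∈ E(K_n)}, where H_e has ns e vertices (Fin (ns e)).
CoronaV : (n : ℕ) → (ns : Edge n → ℕ) → Set
CoronaV n ns = Fin n ⊎ Σ (Edge n) (λ e → Fin (ns e))

data CoronaAdj (n : ℕ) (ns : Edge n → ℕ) (H : (e : Edge n) → SimpleGraph (Fin (ns e)))
     : CoronaV n ns → CoronaV n ns → Set where
  KK : ∀ {a b} → a ≢ b → CoronaAdj n ns H (inj₁ a) (inj₁ b)
  HH : ∀ {e x y} → Adj (H e) x y → CoronaAdj n ns H (inj₂ (e , x)) (inj₂ (e , y))
  KH : ∀ {a e x} → EndOf a e → CoronaAdj n ns H (inj₁ a) (inj₂ (e , x))
  HK : ∀ {a e x} → EndOf a e → CoronaAdj n ns H (inj₂ (e , x)) (inj₁ a)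

data Walk {V : Set} (G : SimpleGraph V) : V → V → ℕ → Set where
  [] : ∀ {v} → Walk G v v zero
  _∷_ : ∀ {u w v ℓ} → Adj G u w → Walk G w v ℓ → Walk G u v (suc ℓ)

DistLe : {V : Set} → SimpleGraph V → ℕ → V → V → Set
DistLe G k u v = Σ ℕ (λ ℓ → (ℓ ≤ k) × Walk G u v ℓ)

IsDistanceColoring : {V C : Set} → SimpleGraph V → ℕ → (V → C) → Set
IsDistanceColoring G k c = ∀ u v → u ≢ v → DistLe G k u v → c u ≢ c v

ChiDistLe : {V : Set} → SimpleGraph V → ℕ → ℕ → Set
ChiDistLe {V} G k m = Σ (V → Fin m) (IsDistanceColoring G k)

-- t is the maximum of ns over the (finite) edge set (0 if there are no edges):
-- least upper bound.
IsMax : ∀ {n} → (Edge n → ℕ) → ℕ → Set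
IsMax {n} ns t = (∀ e → ns e ≤ t) × (∀ s → (∀ e → ns e ≤ s) → t ≤ s)

bound : ℕ → ℕ → ℕ
bound n t with n % 2
... | 1 = n * (t + 1)
... | _ = n * (t + 1) ∸ t

corona : (n : ℕ) (ns : Edge n → ℕ) (H : (e : Edge n) → SimpleGraph (Fin (ns e)))
       → SimpleGraph (CoronaV n ns)
corona n ns H = record { Adj = CoronaAdj n ns H ; sym = sy ; irrefl = irr }
  where
  sy : ∀ {u v} → CoronaAdj n ns H u v → CoronaAdj n ns H v u
  sy (KK p) = KK (λ q → p (Relation.Binary.PropositionalEquality.sym q))
  sy (HH {e} p) = HH (SimpleGraph.sym (H e) p)
  sy (KH p) = HK p
  sy (HK p) = KH p
  irr : ∀ {v} → ¬ CoronaAdj n ns H v v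
  irr (KK p) = p Relation.Binary.PropositionalEquality.refl
  irr (HH {e} p) = SimpleGraph.irrefl (H e) p

-- Colour the vertices of K_n with 0 … n-1.  Given a proper edge colouring of K_n
-- with m colours and t ≥ |H_e| for every edge e, colour vertex x of H_e with
-- n + colour(e)·t + x.  Two hanging vertices at distance ≤ 2 lie in the same H_e or
-- in H_e, H_e' for edges e, e' sharing an end vertex, hence their edges carry
-- distinct edge colours (or coincide); uniqueness of division with remainder then
-- separates their colours.  This uses n + m t colours in total.
--
-- Edge colourings of K_n are obtained from symmetric "latin" colourings of vertex
-- pairs (the colours around each vertex are distinct): the cyclic colouring a+b mod n
-- uses n colours for every n, and for even n = m+1 (m odd) colouring {a,b} by a+b mod m
-- and {a,m} by 2a mod m uses m colours.  Since n + n t = n(t+1) and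
-- (m+1) + m t = n(t+1) - t, a parity case split on n gives the theorem.
module Submission where

open import Defs hiding (sym)
open import Data.Nat using (ℕ; zero; suc; _+_; _*_; _∸_; _≤_; _<_; _%_; z≤n; s≤s; _<?_; _≟_; >-nonZero; NonZero)
open import Data.Nat.Properties
open import Data.Nat.DivMod using (%-congˡ; [m+kn]%n≡m%n; m<n⇒m%n≡m; m*n%n≡0)
open import Data.Nat.Tactic.RingSolver using (solve-∀)
open import Data.Fin using (Fin; toℕ; fromℕ<)
open import Data.Fin.Properties using (toℕ<n; toℕ-injective; toℕ-fromℕ<)
open import Data.Product using (Σ; _×_; _,_)
open import Data.Sum using (_⊎_; inj₁; inj₂)
open import Data.Empty using (⊥-elim)
open import Function using (_∘_)
open import Relation.Nullary using (yes; no)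
open import Relation.Binary.PropositionalEquality

colouringBelow : ∀ {V : Set} {G : SimpleGraph V} {d k} (c : V → ℕ) → (∀ v → c v < k)
  → (∀ u v → u ≢ v → DistLe G d u v → c u ≢ c v) → ChiDistLe G d k
colouringBelow c c<k separates =
  (λ v → fromℕ< (c<k v)) ,
  λ u v u≢v near same → separates u v u≢v near
    (trans (sym (toℕ-fromℕ< (c<k u))) (trans (cong toℕ same) (toℕ-fromℕ< (c<k v))))

quotRem-unique : ∀ {t q q' r r'} → r < t → r' < t → q * t + r ≡ q' * t + r' → q ≡ q' × r ≡ r'
quotRem-unique {t} {q} {q'} {r} {r'} r<t r'<t eq = quotients , remainders
  where
  instance
    t≢0 : NonZero t
    t≢0 = >-nonZero (≤-<-trans z≤n r<t)

  remainder : ∀ q {r} → r < t → (q * t + r) % t ≡ r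
  remainder q {r} r<t =
    trans (%-congˡ (+-comm (q * t) r)) (trans ([m+kn]%n≡m%n r q t) (m<n⇒m%n≡m r<t))

  remainders : r ≡ r'
  remainders = trans (sym (remainder q r<t)) (trans (%-congˡ eq) (remainder q' r'<t))

  quotients : q ≡ q'
  quotients = *-cancelʳ-≡ q q' t
    (+-cancelʳ-≡ r (q * t) (q' * t) (trans eq (cong (q' * t +_) (sym remainders))))

SharesEnd : ∀ {n} → Edge n → Edge n → Set
SharesEnd {n} e e' = Σ (Fin n) λ a → EndOf a e × EndOf a e'

record ProperEdgeColouring (n m : ℕ) : Set where
  field
    colour  : Edge n → ℕ
    colour< : ∀ e → colour e < m
    proper  : ∀ {e e'} → SharesEnd e e' → colour e ≡ colour e' → e ≡ e'

record LatinPairColouring (n m : ℕ) : Set where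
  field
    pair     : ℕ → ℕ → ℕ
    pair-sym : ∀ a b → pair a b ≡ pair b a
    pair<    : ∀ {a b} → a < b → b < n → pair a b < m
    latin    : ∀ {a b b'} → a < n → b < n → b' < n → a ≢ b → a ≢ b'
             → pair a b ≡ pair a b' → b ≡ b'

module _ {n m : ℕ} (L : LatinPairColouring n m) where
  open LatinPairColouring L

  edgeColour : Edge n → ℕ
  edgeColour ((u , v) , _) = pair (toℕ u) (toℕ v)

  partner : ∀ {a} e → EndOf a e → Fin n
  partner ((u , v) , _) (inj₁ _) = v
  partner ((u , v) , _) (inj₂ _) = u

  partner≢ : ∀ {a} e (end : EndOf a e) → toℕ a ≢ toℕ (partner e end)
  partner≢ (_ , u<v) (inj₁ refl) = <⇒≢ u<v
  partner≢ (_ , u<v) (inj₂ refl) = ≢-sym (<⇒≢ u<v)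

  colourAround : ∀ {a} e (end : EndOf a e) → edgeColour e ≡ pair (toℕ a) (toℕ (partner e end))
  colourAround _ (inj₁ refl) = refl
  colourAround ((u , v) , _) (inj₂ refl) = pair-sym (toℕ u) (toℕ v)

  edgeByPartner : ∀ {a} e e' (end : EndOf a e) (end' : EndOf a e')
    → partner e end ≡ partner e' end' → e ≡ e'
  edgeByPartner (_ , p) (_ , p') (inj₁ refl) (inj₁ refl) refl = cong (_ ,_) (<-irrelevant p p')
  edgeByPartner (_ , p) (_ , p') (inj₁ refl) (inj₂ refl) refl = ⊥-elim (<-asym p p')
  edgeByPartner (_ , p) (_ , p') (inj₂ refl) (inj₁ refl) refl = ⊥-elim (<-asym p p')
  edgeByPartner (_ , p) (_ , p') (inj₂ refl) (inj₂ refl) refl = cong (_ ,_) (<-irrelevant p p')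

  latinEdgeColouring : ProperEdgeColouring n m
  latinEdgeColouring = record
    { colour  = edgeColour
    ; colour< = λ { ((u , v) , u<v) → pair< u<v (toℕ<n v) }
    ; proper  = λ { {e} {e'} (a , end , end') same → edgeByPartner e e' end end'
        (toℕ-injective (latin (toℕ<n a) (toℕ<n _) (toℕ<n _) (partner≢ e end) (partner≢ e' end')
          (trans (sym (colourAround e end)) (trans same (colourAround e' end'))))) }
    }

-- reduce m x is x mod m for x < 2m: subtract m once if possible.
reduce : ℕ → ℕ → ℕ
reduce m x with x <? m
... | yes _ = x
... | no _  = x ∸ m

reduce< : ∀ {m x} → x < m + m → reduce m x < m
reduce< {m} {x} x<2m with x <? m
... | yes x<m = x<m
... | no x≮m  = +-cancelʳ-< m (x ∸ m) m (subst (_< m + m) (sym (m∸n+n≡m (≮⇒≥ x≮m))) x<2m)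

reduce-collision : ∀ {m x y} → reduce m x ≡ reduce m y → x ≡ y ⊎ (x + m ≡ y ⊎ y + m ≡ x)
reduce-collision {m} {x} {y} eq with x <? m | y <? m
... | yes _   | yes _   = inj₁ eq
... | no x≮m  | no y≮m  = inj₁ (trans (sym (m∸n+n≡m (≮⇒≥ x≮m)))
                                  (trans (cong (_+ m) eq) (m∸n+n≡m (≮⇒≥ y≮m))))
... | yes _   | no y≮m  = inj₂ (inj₁ (trans (cong (_+ m) eq) (m∸n+n≡m (≮⇒≥ y≮m))))
... | no x≮m  | yes _   = inj₂ (inj₂ (trans (cong (_+ m) (sym eq)) (m∸n+n≡m (≮⇒≥ x≮m))))

overshoot : ∀ {m} a c {c'} → a + c + m ≡ a + c' → m ≤ c'
overshoot {m} a c {c'} e =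
  subst (m ≤_) (+-cancelˡ-≡ a (c + m) c' (trans (sym (+-assoc a c m)) e)) (m≤n+m m c)

reduce-+-cancelˡ : ∀ {m} a {b b'} → b < m → b' < m → reduce m (a + b) ≡ reduce m (a + b') → b ≡ b'
reduce-+-cancelˡ a {b} {b'} b<m b'<m eq with reduce-collision eq
... | inj₁ same        = +-cancelˡ-≡ a b b' same
... | inj₂ (inj₁ over) = ⊥-elim (<⇒≱ b'<m (overshoot a b over))
... | inj₂ (inj₂ over) = ⊥-elim (<⇒≱ b<m (overshoot a b' over))

-- 2x written as a sum, the form in which doubles occur in the pair colourings.
double : ∀ x → 2 * x ≡ x + x
double x = cong (x +_) (+-identityʳ x)

even+odd : ∀ x k → x + x + suc (2 * k) ≡ suc (2 * (x + k))
even+odd = solve-∀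

-- Doubling is injective modulo an odd m: the even numbers 2b and 2b' never
-- differ by exactly m.
reduce-double-injective : ∀ k {b b'} → let m = suc (2 * k) in
  reduce m (b + b) ≡ reduce m (b' + b') → b ≡ b'
reduce-double-injective k {b} {b'} eq with reduce-collision eq
... | inj₁ same        = *-cancelˡ-≡ b b' 2 (trans (double b) (trans same (sym (double b'))))
... | inj₂ (inj₁ over) = ⊥-elim (even≢odd b' (b + k) (trans (double b') (trans (sym over) (even+odd b k))))
... | inj₂ (inj₂ over) = ⊥-elim (even≢odd b (b' + k) (trans (double b) (trans (sym over) (even+odd b' k))))

cyclicPairColouring : ∀ n → LatinPairColouring n n
cyclicPairColouring n = record
  { pair     = λ a b → reduce n (a + b)
  ; pair-sym = λ a b → cong (reduce n) (+-comm a b)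
  ; pair<    = λ a<b b<n → reduce< (+-mono-< (<-trans a<b b<n) b<n)
  ; latin    = λ {a} _ b<n b'<n _ _ → reduce-+-cancelˡ a b<n b'<n
  }

-- Around a vertex a < m the
-- colours are the distinct translates a + b, where 2a = a + a accounts for b = m;
-- around m they are the distinct doubles 2b, as m is odd.
module EvenPairs (k : ℕ) where
  m : ℕ
  m = suc (2 * k)

  pair : ℕ → ℕ → ℕ
  pair a b with a ≟ m | b ≟ m
  ... | yes _ | _     = reduce m (b + b)
  ... | no _  | yes _ = reduce m (a + a)
  ... | no _  | no _  = reduce m (a + b)

  pair-sym : ∀ a b → pair a b ≡ pair b a
  pair-sym a b with a ≟ m | b ≟ m
  ... | yes a≡m | yes b≡m = cong (λ x → reduce m (x + x)) (trans b≡m (sym a≡m))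
  ... | yes _   | no _    = refl
  ... | no _    | yes _   = refl
  ... | no _    | no _    = cong (reduce m) (+-comm a b)

  belowSpecial : ∀ {a} → a < suc m → a ≢ m → a < m
  belowSpecial a≤m a≢m = ≤∧≢⇒< (≤-pred a≤m) a≢m

  pair< : ∀ {a b} → a < b → b < suc m → pair a b < m
  pair< {a} {b} a<b b<n with a ≟ m | b ≟ m
  ... | yes refl | _       = ⊥-elim (<⇒≱ a<b (≤-pred b<n))
  ... | no _     | yes _   = reduce< (+-mono-< a<m a<m)
    where
    a<m : a < m
    a<m = <-≤-trans a<b (≤-pred b<n)
  ... | no _     | no b≢m  = reduce< (+-mono-< (<-trans a<b b<m) b<m)
    where
    b<m : b < m
    b<m = belowSpecial b<n b≢m

  latin : ∀ {a b b'} → a < suc m → b < suc m → b' < suc m → a ≢ b → a ≢ b'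
        → pair a b ≡ pair a b' → b ≡ b'
  latin {a} {b} {b'} a<n b<n b'<n a≢b a≢b' eq with a ≟ m | b ≟ m | b' ≟ m
  ... | yes refl | _       | _        = reduce-double-injective k eq
  ... | no _     | yes b≡m | yes b'≡m = trans b≡m (sym b'≡m)
  ... | no a≢m   | yes _   | no b'≢m  =
    ⊥-elim (a≢b' (reduce-+-cancelˡ a (belowSpecial a<n a≢m) (belowSpecial b'<n b'≢m) eq))
  ... | no a≢m   | no b≢m  | yes _    =
    ⊥-elim (a≢b (sym (reduce-+-cancelˡ a (belowSpecial b<n b≢m) (belowSpecial a<n a≢m) eq)))
  ... | no _     | no b≢m  | no b'≢m  =
    reduce-+-cancelˡ a (belowSpecial b<n b≢m) (belowSpecial b'<n b'≢m) eq

  evenPairColouring : LatinPairColouring (suc m) m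
  evenPairColouring = record { pair = pair ; pair-sym = pair-sym ; pair< = pair< ; latin = latin }

nearbyEdges : ∀ {n ns H ℓ e e' x y} → ℓ ≤ 2
  → Walk (corona n ns H) (inj₂ (e , x)) (inj₂ (e' , y)) ℓ → e ≡ e' ⊎ SharesEnd e e'
nearbyEdges _ []                        = inj₁ refl
nearbyEdges _ (HH _ ∷ [])               = inj₁ refl
nearbyEdges _ (HH _ ∷ (HH _ ∷ []))      = inj₁ refl
nearbyEdges _ (HK end ∷ (KH end' ∷ [])) = inj₂ (_ , end , end')
nearbyEdges (s≤s (s≤s ())) (_ ∷ (_ ∷ (_ ∷ _)))

module CoronaColouring {n m : ℕ} {ns : Edge n → ℕ} (H : (e : Edge n) → SimpleGraph (Fin (ns e)))
  {t : ℕ} (ns≤t : ∀ e → ns e ≤ t) (C : ProperEdgeColouring n m) where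
  open ProperEdgeColouring C

  col : CoronaV n ns → ℕ
  col (inj₁ a)       = toℕ a
  col (inj₂ (e , x)) = n + (colour e * t + toℕ x)

  x<t : ∀ {e} (x : Fin (ns e)) → toℕ x < t
  x<t {e} x = <-≤-trans (toℕ<n x) (ns≤t e)

  col< : ∀ v → col v < n + m * t
  col< (inj₁ a)       = <-≤-trans (toℕ<n a) (m≤m+n n (m * t))
  col< (inj₂ (e , x)) = +-monoʳ-< n (begin-strict
    colour e * t + toℕ x  <⟨ +-monoʳ-< (colour e * t) (x<t x) ⟩
    colour e * t + t      ≡⟨ +-comm (colour e * t) t ⟩
    suc (colour e) * t    ≤⟨ *-monoˡ-≤ t (colour< e) ⟩
    m * t                 ∎)
    where open ≤-Reasoning

  belowOffset : ∀ {a} c → a < n → a ≢ n + c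
  belowOffset c a<n refl = <⇒≱ a<n (m≤m+n n c)

  separates : ∀ u v → u ≢ v → DistLe (corona n ns H) 2 u v → col u ≢ col v
  separates (inj₁ a) (inj₁ b) u≢v _ same = u≢v (cong inj₁ (toℕ-injective same))
  separates (inj₁ a) (inj₂ (_ , y)) _ _ same = belowOffset _ (toℕ<n a) same
  separates (inj₂ (_ , x)) (inj₁ b) _ _ same = belowOffset _ (toℕ<n b) (sym same)
  separates (inj₂ (e , x)) (inj₂ (e' , y)) u≢v (_ , ℓ≤2 , walk) same
    with quotRem-unique (x<t x) (x<t y) (+-cancelˡ-≡ n _ _ same)
  ... | sameColour , sameIndex = u≢v (vertexEq (sameEdge (nearbyEdges ℓ≤2 walk)))
    where
    sameEdge : e ≡ e' ⊎ SharesEnd e e' → e ≡ e'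
    sameEdge (inj₁ e≡e') = e≡e'
    sameEdge (inj₂ shared) = proper shared sameColour
    vertexEq : e ≡ e' → inj₂ (e , x) ≡ inj₂ (e' , y)
    vertexEq refl = cong (λ z → inj₂ (e , z)) (toℕ-injective sameIndex)

coronaColouring : ∀ {n m ns t B} {H : (e : Edge n) → SimpleGraph (Fin (ns e))}
  → ProperEdgeColouring n m → (∀ e → ns e ≤ t) → n + m * t ≤ B → ChiDistLe (corona n ns H) 2 B
coronaColouring {H = H} C ns≤t enough =
  colouringBelow col (λ v → <-≤-trans (col< v) enough) separates
  where open CoronaColouring H ns≤t C

data ParityView : ℕ → Set where
  isZero : ParityView 0
  isOdd  : ∀ k → ParityView (suc (2 * k))
  isEven : ∀ k → ParityView (suc (suc (2 * k)))

parityView : ∀ n → ParityView n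
parityView zero = isZero
parityView (suc n) with parityView n
... | isZero   = isOdd 0
... | isOdd k  = isEven k
... | isEven k = subst ParityView (cong (suc ∘ suc) (+-suc k (k + 0))) (isOdd (suc k))

bound-odd : ∀ n t → n % 2 ≡ 1 → bound n t ≡ n * (t + 1)
bound-odd n t odd with n % 2
... | 1 = refl

bound-even : ∀ n t → n % 2 ≡ 0 → bound n t ≡ n * (t + 1) ∸ t
bound-even n t even with n % 2
... | 0 = refl

oddCount : ∀ k t → let n = suc (2 * k) in n + n * t ≡ bound n t
oddCount k t = trans (count (suc (2 * k)) t) (sym (bound-odd (suc (2 * k)) t remainder1))
  where
  count : ∀ n t → n + n * t ≡ n * (t + 1)
  count = solve-∀
  remainder1 : suc (2 * k) % 2 ≡ 1
  remainder1 = trans (cong (_% 2) (cong suc (*-comm 2 k))) ([m+kn]%n≡m%n 1 k 2)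

evenCount : ∀ k t → let m = suc (2 * k) in suc m + m * t ≡ bound (suc m) t
evenCount k t = trans (sym (m+n∸n≡m (suc m + m * t) t))
  (trans (cong (_∸ t) (count m t)) (sym (bound-even (suc m) t remainder0)))
  where
  m : ℕ
  m = suc (2 * k)
  count : ∀ m t → suc m + m * t + t ≡ suc m * (t + 1)
  count = solve-∀
  remainder0 : suc m % 2 ≡ 0
  remainder0 = trans (cong (_% 2) (cong (suc ∘ suc) (*-comm 2 k))) (m*n%n≡0 (suc k) 2)

mainTheorem4 : (n : ℕ) (ns : Edge n → ℕ) (H : (e : Edge n) → SimpleGraph (Fin (ns e)))
    (t : ℕ) → IsMax ns t →
    ChiDistLe (corona n ns H) 2 (bound n t)
mainTheorem4 n ns H t (ns≤t , _) with parityView n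
... | isZero   = coronaColouring (latinEdgeColouring (cyclicPairColouring 0)) ns≤t z≤n
... | isOdd k  = coronaColouring (latinEdgeColouring (cyclicPairColouring (suc (2 * k)))) ns≤t
                   (≤-reflexive (oddCount k t))
... | isEven k = coronaColouring (latinEdgeColouring (EvenPairs.evenPairColouring k)) ns≤t
                   (≤-reflexive (evenCount k t))
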